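{- Let $\Sigma$ be any set of sequents in the language of $\mathbf{MPDBL}$. If an s-hypersequent $\alpha_1\vdash\beta_1\mid\dots\mid\alpha_n\vdash\beta_n$ is provable in $\mathbf{MPDBL}\Sigma$, then it is valid in the class $V_\Sigma$ of all pure double Boolean algebras with operators in which every sequent of $\Sigma$ is valid.
   Context: Pure double Boolean algebras. A double Boolean algebra is an algebra $\mathbf{D}=(D,\sqcup,\sqcap,\neg,\lrcorner,\top,\bot)$ such that, writing $x\vee y:=\neg(\neg x\sqcap\neg y)$ and $x\wedge y:=\lrcorner(\lrcorner x\sqcup\lrcorner y)$, for all $x,y,z$: $(x\sqcap x)\sqcap y=x\sqcap y$; $(x\sqcup x)\sqcup y=x\sqcup y$; $\sqcap,\sqcup$ commutative and associative; $\neg(x\sqcap x)=\neg x$; $\lrcorner(x\sqcup x)=\lrcorner x$; $x\sqcap(x\sqcup y)=x\sqcap x$; $x\sqcup(x\sqcap y)=x\sqcup x$; $x\sqcap(y\vee z)=(x\sqcap y)\vee(x\sqcap z)$; $x\sqcup(y\wedge z)=(x\sqcup y)\wedge(x\sqcup z)$; $x\sqcap(x\vee y)=x\sqcap x$; $x\sqcup(x\wedge y)=x\sqcup x$; $\neg\neg(x\sqcap y)=x\sqcap y$; $\lrcorner\lrcorner(x\sqcup y)=x\sqcup y$; $x\sqcap\neg x=\bot$; $x\sqcup\lrcorner x=\top$; $\neg\bot=\top\sqcap\top$; $\lrcorner\top=\bot\sqcup\bot$; $\neg\top=\bot$; $\lrcorner\bot=\top$; $(x\sqcap x)\sqcup(x\sqcap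 x)=(x\sqcup x)\sqcap(x\sqcup x)$. It is pure (pdBa) if each $x$ satisfies $x\sqcap x=x$ or $x\sqcup x=x$. $D_\sqcap=\{x:x\sqcap x=x\}$, $D_\sqcup=\{x:x\sqcup x=x\}$; $x\sqsubseteq y$ iff $x\sqcap y=x\sqcap x$ and $x\sqcup y=y\sqcup y$. A pdBa with operators (pdBao) is a pdBa with two maps $\mathbf{I},\mathbf{C}:D\to D$, monotone w.r.t. $\sqsubseteq$, such that $\mathbf{I}(x\sqcap y)=\mathbf{I}(x)\sqcap\mathbf{I}(y)$, $\mathbf{C}(x\sqcup y)=\mathbf{C}(x)\sqcup\mathbf{C}(y)$, $\mathbf{I}(\neg\bot)=\neg\bot$, $\mathbf{C}(\lrcorner\top)=\lrcorner\top$, $\mathbf{I}(x\sqcap x)=\mathbf{I}(x)$, $\mathbf{C}(x\sqcup x)=\mathbf{C}(x)$. The logic PDBL. Variables: object variables $\mathbf{OV}$ ($p,\dots$) and property variables $\mathbf{PV}$ ($P,\dots$), disjoint countably infinite sets; constants $\top,\bot$; connectives $\sqcap,\sqcup$ (binary), $\neg,\lrcorner$ (unary). $\alpha\vee\beta:=\neg(\neg\alpha\sqcap\neg\beta)$, $\alpha\wedge\beta:=\lrcorner(\lrcorner\alpha\sqcup\lrcorner\beta)$. Sequents $\alpha\vdash\beta$ ($\alpha\dashv\vdash\beta$ means both directions); s-hypersequents are finite sequences $\alpha_1\vdash\beta_1\mid\dots\mid\alpha_n\vdash\beta_n$; $B,C,\dots,X$ range over possibly empty s-hypersequents. Axioms: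 $\alpha\vdash\alpha$; $\alpha\sqcap\beta\vdash\alpha$; $\alpha\sqcap\beta\vdash\beta$; $\alpha\vdash\alpha\sqcup\beta$; $\beta\vdash\alpha\sqcup\beta$; $\alpha\sqcap\beta\vdash(\alpha\sqcap\beta)\sqcap(\alpha\sqcap\beta)$; $(\alpha\sqcup\beta)\sqcup(\alpha\sqcup\beta)\vdash\alpha\sqcup\beta$; $\neg(\alpha\sqcap\alpha)\vdash\neg\alpha$; $\lrcorner\alpha\vdash\lrcorner(\alpha\sqcup\alpha)$; $\alpha\sqcap\neg\alpha\vdash\bot$; $\top\vdash\alpha\sqcup\lrcorner\alpha$; $\neg\neg(\alpha\sqcap\beta)\dashv\vdash\alpha\sqcap\beta$; $\lrcorner\lrcorner(\alpha\sqcup\beta)\dashv\vdash\alpha\sqcup\beta$; $\alpha\sqcap\alpha\vdash\alpha\sqcap(\alpha\sqcup\beta)$; $\alpha\sqcup(\alpha\sqcap\beta)\vdash\alpha\sqcup\alpha$; $\alpha\sqcap\alpha\vdash\alpha\sqcap(\alpha\vee\beta)$; $\alpha\sqcup(\alpha\wedge\beta)\vdash\alpha\sqcup\alpha$; $\alpha\sqcap(\beta\vee\gamma)\dashv\vdash(\alpha\sqcap\beta)\vee(\alpha\sqcap\gamma)$; $\alpha\sqcup(\beta\wedge\gamma)\dashv\vdash(\alpha\sqcup\beta)\wedge(\alpha\sqcup\gamma)$; $\bot\vdash\alpha$; $\alpha\vdash\top$; $\neg\top\vdash\bot$; $\top\vdash\lrcorner\bot$; $\neg\bot\dashv\vdash\top\sqcap\top$;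 $\lrcorner\top\dashv\vdash\bot\sqcup\bot$; $(\alpha\sqcup\alpha)\sqcap(\alpha\sqcup\alpha)\dashv\vdash(\alpha\sqcap\alpha)\sqcup(\alpha\sqcap\alpha)$; $p\sqcap p\dashv\vdash p$ ($p\in\mathbf{OV}$); $P\sqcup P\dashv\vdash P$ ($P\in\mathbf{PV}$); (Sp) $\alpha\vdash\alpha\sqcap\alpha\mid\alpha\sqcup\alpha\vdash\alpha$. Rules: from $B\mid\alpha\vdash\beta\mid C$ infer $B\mid\alpha\sqcap\gamma\vdash\beta\sqcap\gamma\mid C$, $B\mid\gamma\sqcap\alpha\vdash\gamma\sqcap\beta\mid C$, $B\mid\alpha\sqcup\gamma\vdash\beta\sqcup\gamma\mid C$, $B\mid\gamma\sqcup\alpha\vdash\gamma\sqcup\beta\mid C$, $B\mid\neg\beta\vdash\neg\alpha\mid C$, $B\mid\lrcorner\beta\vdash\lrcorner\alpha\mid C$; from $B\mid\alpha\vdash\beta\mid C$ and $D\mid\beta\vdash\gamma\mid E$ infer $B\mid D\mid\alpha\vdash\gamma\mid C\mid E$; from $B\mid\alpha\sqcap\beta\vdash\alpha\sqcap\alpha\mid C$, $D\mid\alpha\sqcap\alpha\vdash\alpha\sqcap\beta\mid E$, $F\mid\alpha\sqcup\beta\vdash\beta\sqcup\beta\mid G$, $H\mid\beta\sqcup\beta\vdash\alpha\sqcup\beta\mid X$ infer $B\mid D\mid F\mid H\mid\alpha\vdash\beta\mid C\mid E\mid G\mid X$; external: from $B\mid D\mid D\mid C$ infer $B\mid D\mid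 C$; from $B\mid D\mid E\mid C$ infer $B\mid E\mid D\mid C$; from $B$ infer $B\mid C$. MPDBL and MPDBLΣ. $\mathbf{MPDBL}$ adds unary connectives $\square,\blacksquare$ to the language (all PDBL axiom schemes and rules now range over the enlarged set of formulae), with additional axioms $\square\alpha\sqcap\square\beta\dashv\vdash\square(\alpha\sqcap\beta)$; $\blacksquare\alpha\sqcup\blacksquare\beta\dashv\vdash\blacksquare(\alpha\sqcup\beta)$; $\square(\neg\bot)\dashv\vdash\neg\bot$; $\blacksquare(\lrcorner\top)\dashv\vdash\lrcorner\top$; $\square(\alpha\sqcap\alpha)\dashv\vdash\square\alpha$; $\blacksquare(\alpha\sqcup\alpha)\dashv\vdash\blacksquare\alpha$, and rules: from $B\mid\alpha\vdash\beta\mid C$ infer $B\mid\square\alpha\vdash\square\beta\mid C$ and $B\mid\blacksquare\alpha\vdash\blacksquare\beta\mid C$. For a set $\Sigma$ of sequents, $\mathbf{MPDBL}\Sigma$ is $\mathbf{MPDBL}$ with all sequents of $\Sigma$ added as axioms. Provability is via finite derivations. Semantics. A valuation on a pdBao is a map $v$ with $v(p)\in D_\sqcap$, $v(P)\in D_\sqcup$, $v(\top)=\top$, $v(\bot)=\bot$, extended homomorphically, with $v(\square\alpha)=\mathbf{I}(v(\alpha))$, $v(\blacksquare\alpha)=\mathbf{C}(v(\alpha))$. $v$ satisfies $\alpha\vdash\beta$ iff $v(\alpha)\sqsubseteq v(\beta)$, and an s-hypersequent iff it satisfies some component; an s-hypersequent is true in an algebra if every valuation satisfies it and valid in a class if true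 in each member. -}

module Defs where

open import Level using (Level; suc)
open import Data.Nat using (ℕ)
open import Data.Product using (_×_; _,_)
open import Data.Sum using (_⊎_)
open import Data.List using (List; []; _∷_; _++_; [_])
open import Data.List.Relation.Unary.Any using (Any)
open import Relation.Binary.PropositionalEquality using (_≡_)

record PDBAO (c : Level) : Set (suc c) where
  infixl 7 _⊓_
  infixl 6 _⊔_
  infix 8 ¬_ ⌟_
  field
    Carrier : Set c
    _⊔_ _⊓_ : Carrier → Carrier → Carrier
    ¬_ ⌟_ : Carrier → Carrier
    ⊤ ⊥ : Carrier

  _∨_ : Carrier → Carrier → Carrier
  x ∨ y = ¬ (¬ x ⊓ ¬ y)

  _∧_ : Carrier → Carrier → Carrier
  x ∧ y = ⌟ (⌟ x ⊔ ⌟ y)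

  field
    ⊓-idem-l : ∀ x y → (x ⊓ x) ⊓ y ≡ x ⊓ y
    ⊔-idem-l : ∀ x y → (x ⊔ x) ⊔ y ≡ x ⊔ y
    ⊓-comm : ∀ x y → x ⊓ y ≡ y ⊓ x
    ⊔-comm : ∀ x y → x ⊔ y ≡ y ⊔ x
    ⊓-assoc : ∀ x y z → x ⊓ (y ⊓ z) ≡ (x ⊓ y) ⊓ z
    ⊔-assoc : ∀ x y z → x ⊔ (y ⊔ z) ≡ (x ⊔ y) ⊔ z
    ¬-⊓-idem : ∀ x → ¬ (x ⊓ x) ≡ ¬ x
    ⌟-⊔-idem : ∀ x → ⌟ (x ⊔ x) ≡ ⌟ x
    ⊓-absorb : ∀ x y → x ⊓ (x ⊔ y) ≡ x ⊓ x
    ⊔-absorb : ∀ x y → x ⊔ (x ⊓ y) ≡ x ⊔ x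
    ⊓-distrib-∨ : ∀ x y z → x ⊓ (y ∨ z) ≡ (x ⊓ y) ∨ (x ⊓ z)
    ⊔-distrib-∧ : ∀ x y z → x ⊔ (y ∧ z) ≡ (x ⊔ y) ∧ (x ⊔ z)
    ⊓-absorb-∨ : ∀ x y → x ⊓ (x ∨ y) ≡ x ⊓ x
    ⊔-absorb-∧ : ∀ x y → x ⊔ (x ∧ y) ≡ x ⊔ x
    ¬¬-⊓ : ∀ x y → ¬ ¬ (x ⊓ y) ≡ x ⊓ y
    ⌟⌟-⊔ : ∀ x y → ⌟ ⌟ (x ⊔ y) ≡ x ⊔ y
    ⊓-¬ : ∀ x → x ⊓ ¬ x ≡ ⊥
    ⊔-⌟ : ∀ x → x ⊔ ⌟ x ≡ ⊤
    ¬⊥ : ¬ ⊥ ≡ ⊤ ⊓ ⊤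
    ⌟⊤ : ⌟ ⊤ ≡ ⊥ ⊔ ⊥
    ¬⊤ : ¬ ⊤ ≡ ⊥
    ⌟⊥ : ⌟ ⊥ ≡ ⊤
    mixed : ∀ x → (x ⊓ x) ⊔ (x ⊓ x) ≡ (x ⊔ x) ⊓ (x ⊔ x)
    pure : ∀ x → (x ⊓ x ≡ x) ⊎ (x ⊔ x ≡ x)

  infix 4 _⊑_
  _⊑_ : Carrier → Carrier → Set c
  x ⊑ y = (x ⊓ y ≡ x ⊓ x) × (x ⊔ y ≡ y ⊔ y)

  field
    I C : Carrier → Carrier
    I-mono : ∀ {x y} → x ⊑ y → I x ⊑ I y
    C-mono : ∀ {x y} → x ⊑ y → C x ⊑ C y
    I-⊓ : ∀ x y → I (x ⊓ y) ≡ I x ⊓ I y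
    C-⊔ : ∀ x y → C (x ⊔ y) ≡ C x ⊔ C y
    I-¬⊥ : I (¬ ⊥) ≡ ¬ ⊥
    C-⌟⊤ : C (⌟ ⊤) ≡ ⌟ ⊤
    I-idem : ∀ x → I (x ⊓ x) ≡ I x
    C-idem : ∀ x → C (x ⊔ x) ≡ C x

-- Formulae of MPDBL.  Object variables: ov n, property variables: pv n.

infixl 7 _⊓ᶠ_
infixl 6 _⊔ᶠ_
infix 8 ¬ᶠ_ ⌟ᶠ_ □_ ■_

data Fm : Set where
  ov pv : ℕ → Fm
  ⊤ᶠ ⊥ᶠ : Fm
  _⊓ᶠ_ _⊔ᶠ_ : Fm → Fm → Fm
  ¬ᶠ_ ⌟ᶠ_ □_ ■_ : Fm → Fm

_∨ᶠ_ : Fm → Fm → Fm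
a ∨ᶠ b = ¬ᶠ (¬ᶠ a ⊓ᶠ ¬ᶠ b)

_∧ᶠ_ : Fm → Fm → Fm
a ∧ᶠ b = ⌟ᶠ (⌟ᶠ a ⊔ᶠ ⌟ᶠ b)

infix 4 _⊢_
record Seq : Set where
  constructor _⊢_
  field
    lhs rhs : Fm

HSeq : Set
HSeq = List Seq

data Der (Σ : Seq → Set) : HSeq → Set where
  ax-Σ : ∀ {s} → Σ s → Der Σ [ s ]
  ax-id : ∀ a → Der Σ [ a ⊢ a ]
  ax-⊓l : ∀ a b → Der Σ [ a ⊓ᶠ b ⊢ a ]
  ax-⊓r : ∀ a b → Der Σ [ a ⊓ᶠ b ⊢ b ]
  ax-⊔l : ∀ a b → Der Σ [ a ⊢ a ⊔ᶠ b ]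
  ax-⊔r : ∀ a b → Der Σ [ b ⊢ a ⊔ᶠ b ]
  ax-⊓dup : ∀ a b → Der Σ [ a ⊓ᶠ b ⊢ (a ⊓ᶠ b) ⊓ᶠ (a ⊓ᶠ b) ]
  ax-⊔dup : ∀ a b → Der Σ [ (a ⊔ᶠ b) ⊔ᶠ (a ⊔ᶠ b) ⊢ a ⊔ᶠ b ]
  ax-¬idem : ∀ a → Der Σ [ ¬ᶠ (a ⊓ᶠ a) ⊢ ¬ᶠ a ]
  ax-⌟idem : ∀ a → Der Σ [ ⌟ᶠ a ⊢ ⌟ᶠ (a ⊔ᶠ a) ]
  ax-⊓¬ : ∀ a → Der Σ [ a ⊓ᶠ ¬ᶠ a ⊢ ⊥ᶠ ]
  ax-⊔⌟ : ∀ a → Der Σ [ ⊤ᶠ ⊢ a ⊔ᶠ ⌟ᶠ a ]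
  ax-¬¬₁ : ∀ a b → Der Σ [ ¬ᶠ ¬ᶠ (a ⊓ᶠ b) ⊢ a ⊓ᶠ b ]
  ax-¬¬₂ : ∀ a b → Der Σ [ a ⊓ᶠ b ⊢ ¬ᶠ ¬ᶠ (a ⊓ᶠ b) ]
  ax-⌟⌟₁ : ∀ a b → Der Σ [ ⌟ᶠ ⌟ᶠ (a ⊔ᶠ b) ⊢ a ⊔ᶠ b ]
  ax-⌟⌟₂ : ∀ a b → Der Σ [ a ⊔ᶠ b ⊢ ⌟ᶠ ⌟ᶠ (a ⊔ᶠ b) ]
  ax-abs⊓ : ∀ a b → Der Σ [ a ⊓ᶠ a ⊢ a ⊓ᶠ (a ⊔ᶠ b) ]
  ax-abs⊔ : ∀ a b → Der Σ [ a ⊔ᶠ (a ⊓ᶠ b) ⊢ a ⊔ᶠ a ]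
  ax-abs∨ : ∀ a b → Der Σ [ a ⊓ᶠ a ⊢ a ⊓ᶠ (a ∨ᶠ b) ]
  ax-abs∧ : ∀ a b → Der Σ [ a ⊔ᶠ (a ∧ᶠ b) ⊢ a ⊔ᶠ a ]
  ax-dist∨₁ : ∀ a b c → Der Σ [ a ⊓ᶠ (b ∨ᶠ c) ⊢ (a ⊓ᶠ b) ∨ᶠ (a ⊓ᶠ c) ]
  ax-dist∨₂ : ∀ a b c → Der Σ [ (a ⊓ᶠ b) ∨ᶠ (a ⊓ᶠ c) ⊢ a ⊓ᶠ (b ∨ᶠ c) ]
  ax-dist∧₁ : ∀ a b c → Der Σ [ a ⊔ᶠ (b ∧ᶠ c) ⊢ (a ⊔ᶠ b) ∧ᶠ (a ⊔ᶠ c) ]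
  ax-dist∧₂ : ∀ a b c → Der Σ [ (a ⊔ᶠ b) ∧ᶠ (a ⊔ᶠ c) ⊢ a ⊔ᶠ (b ∧ᶠ c) ]
  ax-⊥ : ∀ a → Der Σ [ ⊥ᶠ ⊢ a ]
  ax-⊤ : ∀ a → Der Σ [ a ⊢ ⊤ᶠ ]
  ax-¬⊤ : Der Σ [ ¬ᶠ ⊤ᶠ ⊢ ⊥ᶠ ]
  ax-⌟⊥ : Der Σ [ ⊤ᶠ ⊢ ⌟ᶠ ⊥ᶠ ]
  ax-¬⊥₁ : Der Σ [ ¬ᶠ ⊥ᶠ ⊢ ⊤ᶠ ⊓ᶠ ⊤ᶠ ]
  ax-¬⊥₂ : Der Σ [ ⊤ᶠ ⊓ᶠ ⊤ᶠ ⊢ ¬ᶠ ⊥ᶠ ]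
  ax-⌟⊤₁ : Der Σ [ ⌟ᶠ ⊤ᶠ ⊢ ⊥ᶠ ⊔ᶠ ⊥ᶠ ]
  ax-⌟⊤₂ : Der Σ [ ⊥ᶠ ⊔ᶠ ⊥ᶠ ⊢ ⌟ᶠ ⊤ᶠ ]
  ax-mix₁ : ∀ a → Der Σ [ (a ⊔ᶠ a) ⊓ᶠ (a ⊔ᶠ a) ⊢ (a ⊓ᶠ a) ⊔ᶠ (a ⊓ᶠ a) ]
  ax-mix₂ : ∀ a → Der Σ [ (a ⊓ᶠ a) ⊔ᶠ (a ⊓ᶠ a) ⊢ (a ⊔ᶠ a) ⊓ᶠ (a ⊔ᶠ a) ]
  ax-ov₁ : ∀ p → Der Σ [ ov p ⊓ᶠ ov p ⊢ ov p ]
  ax-ov₂ : ∀ p → Der Σ [ ov p ⊢ ov p ⊓ᶠ ov p ]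
  ax-pv₁ : ∀ P → Der Σ [ pv P ⊔ᶠ pv P ⊢ pv P ]
  ax-pv₂ : ∀ P → Der Σ [ pv P ⊢ pv P ⊔ᶠ pv P ]
  ax-Sp : ∀ a → Der Σ ((a ⊢ a ⊓ᶠ a) ∷ (a ⊔ᶠ a ⊢ a) ∷ [])
  ax-□⊓₁ : ∀ a b → Der Σ [ □ a ⊓ᶠ □ b ⊢ □ (a ⊓ᶠ b) ]
  ax-□⊓₂ : ∀ a b → Der Σ [ □ (a ⊓ᶠ b) ⊢ □ a ⊓ᶠ □ b ]
  ax-■⊔₁ : ∀ a b → Der Σ [ ■ a ⊔ᶠ ■ b ⊢ ■ (a ⊔ᶠ b) ]
  ax-■⊔₂ : ∀ a b → Der Σ [ ■ (a ⊔ᶠ b) ⊢ ■ a ⊔ᶠ ■ b ]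
  ax-□¬⊥₁ : Der Σ [ □ (¬ᶠ ⊥ᶠ) ⊢ ¬ᶠ ⊥ᶠ ]
  ax-□¬⊥₂ : Der Σ [ ¬ᶠ ⊥ᶠ ⊢ □ (¬ᶠ ⊥ᶠ) ]
  ax-■⌟⊤₁ : Der Σ [ ■ (⌟ᶠ ⊤ᶠ) ⊢ ⌟ᶠ ⊤ᶠ ]
  ax-■⌟⊤₂ : Der Σ [ ⌟ᶠ ⊤ᶠ ⊢ ■ (⌟ᶠ ⊤ᶠ) ]
  ax-□idem₁ : ∀ a → Der Σ [ □ (a ⊓ᶠ a) ⊢ □ a ]
  ax-□idem₂ : ∀ a → Der Σ [ □ a ⊢ □ (a ⊓ᶠ a) ]
  ax-■idem₁ : ∀ a → Der Σ [ ■ (a ⊔ᶠ a) ⊢ ■ a ]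
  ax-■idem₂ : ∀ a → Der Σ [ ■ a ⊢ ■ (a ⊔ᶠ a) ]
  r-⊓r : ∀ B C a b c → Der Σ (B ++ (a ⊢ b) ∷ C) → Der Σ (B ++ (a ⊓ᶠ c ⊢ b ⊓ᶠ c) ∷ C)
  r-⊓l : ∀ B C a b c → Der Σ (B ++ (a ⊢ b) ∷ C) → Der Σ (B ++ (c ⊓ᶠ a ⊢ c ⊓ᶠ b) ∷ C)
  r-⊔r : ∀ B C a b c → Der Σ (B ++ (a ⊢ b) ∷ C) → Der Σ (B ++ (a ⊔ᶠ c ⊢ b ⊔ᶠ c) ∷ C)
  r-⊔l : ∀ B C a b c → Der Σ (B ++ (a ⊢ b) ∷ C) → Der Σ (B ++ (c ⊔ᶠ a ⊢ c ⊔ᶠ b) ∷ C)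
  r-¬ : ∀ B C a b → Der Σ (B ++ (a ⊢ b) ∷ C) → Der Σ (B ++ (¬ᶠ b ⊢ ¬ᶠ a) ∷ C)
  r-⌟ : ∀ B C a b → Der Σ (B ++ (a ⊢ b) ∷ C) → Der Σ (B ++ (⌟ᶠ b ⊢ ⌟ᶠ a) ∷ C)
  r-□ : ∀ B C a b → Der Σ (B ++ (a ⊢ b) ∷ C) → Der Σ (B ++ (□ a ⊢ □ b) ∷ C)
  r-■ : ∀ B C a b → Der Σ (B ++ (a ⊢ b) ∷ C) → Der Σ (B ++ (■ a ⊢ ■ b) ∷ C)
  r-cut : ∀ B C D E a b c →
    Der Σ (B ++ (a ⊢ b) ∷ C) → Der Σ (D ++ (b ⊢ c) ∷ E) →
    Der Σ (B ++ D ++ (a ⊢ c) ∷ C ++ E)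
  r-antisym : ∀ B C D E F G H X a b →
    Der Σ (B ++ (a ⊓ᶠ b ⊢ a ⊓ᶠ a) ∷ C) →
    Der Σ (D ++ (a ⊓ᶠ a ⊢ a ⊓ᶠ b) ∷ E) →
    Der Σ (F ++ (a ⊔ᶠ b ⊢ b ⊔ᶠ b) ∷ G) →
    Der Σ (H ++ (b ⊔ᶠ b ⊢ a ⊔ᶠ b) ∷ X) →
    Der Σ (B ++ D ++ F ++ H ++ (a ⊢ b) ∷ C ++ E ++ G ++ X)
  r-EC : ∀ B D C → Der Σ (B ++ D ++ D ++ C) → Der Σ (B ++ D ++ C)
  r-EE : ∀ B D E C → Der Σ (B ++ D ++ E ++ C) → Der Σ (B ++ E ++ D ++ C)
  r-EW : ∀ B C → Der Σ B → Der Σ (B ++ C)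

module _ {c : Level} (A : PDBAO c) where
  open PDBAO A

  record Valuation : Set c where
    field
      vo : ℕ → Carrier
      vo-⊓ : ∀ p → vo p ⊓ vo p ≡ vo p
      vp : ℕ → Carrier
      vp-⊔ : ∀ P → vp P ⊔ vp P ≡ vp P

  ⟦_⟧ : Fm → Valuation → Carrier
  ⟦ ov p ⟧ v = Valuation.vo v p
  ⟦ pv P ⟧ v = Valuation.vp v P
  ⟦ ⊤ᶠ ⟧ v = ⊤
  ⟦ ⊥ᶠ ⟧ v = ⊥
  ⟦ a ⊓ᶠ b ⟧ v = ⟦ a ⟧ v ⊓ ⟦ b ⟧ v
  ⟦ a ⊔ᶠ b ⟧ v = ⟦ a ⟧ v ⊔ ⟦ b ⟧ v
  ⟦ ¬ᶠ a ⟧ v = ¬ ⟦ a ⟧ v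
  ⟦ ⌟ᶠ a ⟧ v = ⌟ ⟦ a ⟧ v
  ⟦ □ a ⟧ v = I (⟦ a ⟧ v)
  ⟦ ■ a ⟧ v = C (⟦ a ⟧ v)

  SatSeq : Valuation → Seq → Set c
  SatSeq v (a ⊢ b) = ⟦ a ⟧ v ⊑ ⟦ b ⟧ v

  SatH : Valuation → HSeq → Set c
  SatH v h = Any (SatSeq v) h

  TrueH : HSeq → Set c
  TrueH h = ∀ v → SatH v h

  TrueSeq : Seq → Set c
  TrueSeq s = ∀ v → SatSeq v s

InV : ∀ {c} → (Seq → Set) → PDBAO c → Set c
InV Σ A = ∀ s → Σ s → TrueSeq A s

{-# OPTIONS --safe #-}
module Submission where

-- Every axiom is an
-- identity or an order fact of pure double Boolean algebras with operators
-- ((Sp) is purity).  An s-hypersequent is satisfied when one of its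
-- components is, so a rule acting on one focused component only has to map
-- the semantics of the premise's focus to that of the conclusion's, carrying
-- the side components along: the connectives are monotone or antitone for ⊑,
-- cut is transitivity of ⊑, and the antisymmetry rule holds because ⊑ is
-- antisymmetric on D⊓ and on D⊔.

open import Defs
open import Level using (Level)
open import Algebra.Bundles using (CommutativeSemigroup)
import Algebra.Properties.CommutativeSemigroup as CommutativeSemigroupProperties
open import Function using (_∘_; id)
open import Data.Product using (_,_)
open import Data.Sum using (_⊎_; inj₁; inj₂; [_,_]′)
import Data.Sum as Sum
open import Data.List using (_∷_; _++_; [_])
open import Data.List.Relation.Unary.Any using (Any; here; there; toSum; fromSum)
open import Data.List.Relation.Unary.Any.Properties using (++⁺ˡ; ++⁺ʳ; ++⁻)
open import Data.List.Relation.Binary.Permutation.Propositional using (_↭_; ↭-refl; ↭-sym)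
import Data.List.Relation.Binary.Permutation.Propositional.Properties as ↭
open ↭ using (Any-resp-↭; shift; shifts; ++-commutativeMonoid)
import Algebra.Solver.CommutativeMonoid as CommutativeMonoidSolver
open import Relation.Unary using (Pred; _∈_)
open import Relation.Binary.PropositionalEquality
  using (_≡_; refl; sym; trans; cong; cong₂; subst; subst₂; isEquivalence; module ≡-Reasoning)

≡-commutativeSemigroup : ∀ {a} {X : Set a} (_∙_ : X → X → X) →
  (∀ x y → x ∙ y ≡ y ∙ x) → (∀ x y z → x ∙ (y ∙ z) ≡ (x ∙ y) ∙ z) →
  CommutativeSemigroup a a
≡-commutativeSemigroup _∙_ comm assoc = record
  { isCommutativeSemigroup = record
    { isSemigroup = record
      { isMagma = record { isEquivalence = isEquivalence ; ∙-cong = cong₂ _∙_ }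
      ; assoc = λ x y z → sym (assoc x y z)
      }
    ; comm = comm
    }
  }

module PDBAOProperties {c : Level} (A : PDBAO c) where
  open PDBAO A
  open ≡-Reasoning

  open CommutativeSemigroupProperties (≡-commutativeSemigroup _⊓_ ⊓-comm ⊓-assoc)
    using () renaming (interchange to ⊓-interchange)
  open CommutativeSemigroupProperties (≡-commutativeSemigroup _⊔_ ⊔-comm ⊔-assoc)
    using () renaming (interchange to ⊔-interchange)

  D⊓ D⊔ : Pred Carrier c
  D⊓ x = x ⊓ x ≡ x
  D⊔ x = x ⊔ x ≡ x

  ¬¬x≡x⊓x : ∀ x → ¬ ¬ x ≡ x ⊓ x
  ¬¬x≡x⊓x x = trans (cong ¬_ (sym (¬-⊓-idem x))) (¬¬-⊓ x x)

  ⌟⌟x≡x⊔x : ∀ x → ⌟ ⌟ x ≡ x ⊔ x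
  ⌟⌟x≡x⊔x x = trans (cong ⌟_ (sym (⌟-⊔-idem x))) (⌟⌟-⊔ x x)

  ⊓∈D⊓ : ∀ x y → x ⊓ y ∈ D⊓
  ⊓∈D⊓ x y = trans (sym (¬¬x≡x⊓x (x ⊓ y))) (¬¬-⊓ x y)

  ⊔∈D⊔ : ∀ x y → x ⊔ y ∈ D⊔
  ⊔∈D⊔ x y = trans (sym (⌟⌟x≡x⊔x (x ⊔ y))) (⌟⌟-⊔ x y)

  ¬∈D⊓ : ∀ x → ¬ x ∈ D⊓
  ¬∈D⊓ x = begin
    ¬ x ⊓ ¬ x  ≡⟨ sym (¬¬x≡x⊓x (¬ x)) ⟩
    ¬ ¬ ¬ x    ≡⟨ cong ¬_ (¬¬x≡x⊓x x) ⟩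
    ¬ (x ⊓ x)  ≡⟨ ¬-⊓-idem x ⟩
    ¬ x        ∎

  ⌟∈D⊔ : ∀ x → ⌟ x ∈ D⊔
  ⌟∈D⊔ x = begin
    ⌟ x ⊔ ⌟ x  ≡⟨ sym (⌟⌟x≡x⊔x (⌟ x)) ⟩
    ⌟ ⌟ ⌟ x    ≡⟨ cong ⌟_ (⌟⌟x≡x⊔x x) ⟩
    ⌟ (x ⊔ x)  ≡⟨ ⌟-⊔-idem x ⟩
    ⌟ x        ∎

  ⊥∈D⊓ : ⊥ ∈ D⊓
  ⊥∈D⊓ = subst D⊓ (⊓-¬ ⊤) (⊓∈D⊓ ⊤ (¬ ⊤))

  ⊤∈D⊔ : ⊤ ∈ D⊔
  ⊤∈D⊔ = subst D⊔ (⊔-⌟ ⊥) (⊔∈D⊔ ⊥ (⌟ ⊥))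

  ⊑-refl : ∀ {x} → x ⊑ x
  ⊑-refl = refl , refl

  ⊑-reflexive : ∀ {x y} → x ≡ y → x ⊑ y
  ⊑-reflexive refl = ⊑-refl

  ⊑-trans : ∀ {x y z} → x ⊑ y → y ⊑ z → x ⊑ z
  ⊑-trans {x} {y} {z} (x⊓y≡x⊓x , x⊔y≡y⊔y) (y⊓z≡y⊓y , y⊔z≡z⊔z) = meets , joins
    where
    meets : x ⊓ z ≡ x ⊓ x
    meets = begin
      x ⊓ z        ≡⟨ sym (⊓-idem-l x z) ⟩
      x ⊓ x ⊓ z    ≡⟨ cong (_⊓ z) (sym x⊓y≡x⊓x) ⟩
      x ⊓ y ⊓ z    ≡⟨ sym (⊓-assoc x y z) ⟩
      x ⊓ (y ⊓ z)  ≡⟨ cong (x ⊓_) y⊓z≡y⊓y ⟩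
      x ⊓ (y ⊓ y)  ≡⟨ ⊓-comm x (y ⊓ y) ⟩
      y ⊓ y ⊓ x    ≡⟨ ⊓-idem-l y x ⟩
      y ⊓ x        ≡⟨ ⊓-comm y x ⟩
      x ⊓ y        ≡⟨ x⊓y≡x⊓x ⟩
      x ⊓ x        ∎
    joins : x ⊔ z ≡ z ⊔ z
    joins = begin
      x ⊔ z        ≡⟨ ⊔-comm x z ⟩
      z ⊔ x        ≡⟨ sym (⊔-idem-l z x) ⟩
      z ⊔ z ⊔ x    ≡⟨ ⊔-comm (z ⊔ z) x ⟩
      x ⊔ (z ⊔ z)  ≡⟨ cong (x ⊔_) (sym y⊔z≡z⊔z) ⟩
      x ⊔ (y ⊔ z)  ≡⟨ ⊔-assoc x y z ⟩
      x ⊔ y ⊔ z    ≡⟨ cong (_⊔ z) x⊔y≡y⊔y ⟩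
      y ⊔ y ⊔ z    ≡⟨ ⊔-idem-l y z ⟩
      y ⊔ z        ≡⟨ y⊔z≡z⊔z ⟩
      z ⊔ z        ∎

  D⊓-antisym : ∀ {x y} → x ∈ D⊓ → y ∈ D⊓ → x ⊑ y → y ⊑ x → x ≡ y
  D⊓-antisym {x} {y} x∈D⊓ y∈D⊓ (x⊓y≡x⊓x , _) (y⊓x≡y⊓y , _) = begin
    x      ≡⟨ sym x∈D⊓ ⟩
    x ⊓ x  ≡⟨ sym x⊓y≡x⊓x ⟩
    x ⊓ y  ≡⟨ ⊓-comm x y ⟩
    y ⊓ x  ≡⟨ y⊓x≡y⊓y ⟩
    y ⊓ y  ≡⟨ y∈D⊓ ⟩
    y      ∎

  D⊔-antisym : ∀ {x y} → x ∈ D⊔ → y ∈ D⊔ → x ⊑ y → y ⊑ x → x ≡ y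
  D⊔-antisym {x} {y} x∈D⊔ y∈D⊔ (_ , x⊔y≡y⊔y) (_ , y⊔x≡x⊔x) = begin
    x      ≡⟨ sym x∈D⊔ ⟩
    x ⊔ x  ≡⟨ sym y⊔x≡x⊔x ⟩
    y ⊔ x  ≡⟨ ⊔-comm y x ⟩
    x ⊔ y  ≡⟨ x⊔y≡y⊔y ⟩
    y ⊔ y  ≡⟨ y∈D⊔ ⟩
    y      ∎

  ⊑-antisym-rule : ∀ {x y} → x ⊓ y ⊑ x ⊓ x → x ⊓ x ⊑ x ⊓ y →
                   x ⊔ y ⊑ y ⊔ y → y ⊔ y ⊑ x ⊔ y → x ⊑ y
  ⊑-antisym-rule {x} {y} p q r s =
    D⊓-antisym (⊓∈D⊓ x y) (⊓∈D⊓ x x) p q , D⊔-antisym (⊔∈D⊔ x y) (⊔∈D⊔ y y) r s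

  x⊓y≡x⇒x⊑y : ∀ {x y} → x ∈ D⊓ → x ⊓ y ≡ x → x ⊑ y
  x⊓y≡x⇒x⊑y {x} {y} x∈D⊓ x⊓y≡x = trans x⊓y≡x (sym x∈D⊓) , (begin
    x ⊔ y        ≡⟨ cong (_⊔ y) (sym x⊓y≡x) ⟩
    x ⊓ y ⊔ y    ≡⟨ ⊔-comm (x ⊓ y) y ⟩
    y ⊔ (x ⊓ y)  ≡⟨ cong (y ⊔_) (⊓-comm x y) ⟩
    y ⊔ (y ⊓ x)  ≡⟨ ⊔-absorb y x ⟩
    y ⊔ y        ∎)

  x⊔y≡y⇒x⊑y : ∀ {x y} → y ∈ D⊔ → x ⊔ y ≡ y → x ⊑ y
  x⊔y≡y⇒x⊑y {x} {y} y∈D⊔ x⊔y≡y = (begin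
    x ⊓ y        ≡⟨ cong (x ⊓_) (sym x⊔y≡y) ⟩
    x ⊓ (x ⊔ y)  ≡⟨ ⊓-absorb x y ⟩
    x ⊓ x        ∎) , trans x⊔y≡y (sym y∈D⊔)

  x⊓y⊑x : ∀ x y → x ⊓ y ⊑ x
  x⊓y⊑x x y = x⊓y≡x⇒x⊑y (⊓∈D⊓ x y) (begin
    x ⊓ y ⊓ x    ≡⟨ ⊓-comm (x ⊓ y) x ⟩
    x ⊓ (x ⊓ y)  ≡⟨ ⊓-assoc x x y ⟩
    x ⊓ x ⊓ y    ≡⟨ ⊓-idem-l x y ⟩
    x ⊓ y        ∎)

  x⊓y⊑y : ∀ x y → x ⊓ y ⊑ y
  x⊓y⊑y x y = subst (_⊑ y) (⊓-comm y x) (x⊓y⊑x y x)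

  x⊑x⊔y : ∀ x y → x ⊑ x ⊔ y
  x⊑x⊔y x y = x⊔y≡y⇒x⊑y (⊔∈D⊔ x y) (trans (⊔-assoc x x y) (⊔-idem-l x y))

  y⊑x⊔y : ∀ x y → y ⊑ x ⊔ y
  y⊑x⊔y x y = subst (y ⊑_) (⊔-comm y x) (x⊑x⊔y y x)

  ⊥⊑x : ∀ x → ⊥ ⊑ x
  ⊥⊑x x = x⊓y≡x⇒x⊑y ⊥∈D⊓ (begin
    ⊥ ⊓ x          ≡⟨ ⊓-comm ⊥ x ⟩
    x ⊓ ⊥          ≡⟨ cong (x ⊓_) (sym (⊓-¬ x)) ⟩
    x ⊓ (x ⊓ ¬ x)  ≡⟨ ⊓-assoc x x (¬ x) ⟩
    x ⊓ x ⊓ ¬ x    ≡⟨ ⊓-idem-l x (¬ x) ⟩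
    x ⊓ ¬ x        ≡⟨ ⊓-¬ x ⟩
    ⊥              ∎)

  x⊑⊤ : ∀ x → x ⊑ ⊤
  x⊑⊤ x = x⊔y≡y⇒x⊑y ⊤∈D⊔ (begin
    x ⊔ ⊤          ≡⟨ cong (x ⊔_) (sym (⊔-⌟ x)) ⟩
    x ⊔ (x ⊔ ⌟ x)  ≡⟨ ⊔-assoc x x (⌟ x) ⟩
    x ⊔ x ⊔ ⌟ x    ≡⟨ ⊔-idem-l x (⌟ x) ⟩
    x ⊔ ⌟ x        ≡⟨ ⊔-⌟ x ⟩
    ⊤              ∎)

  ⊓-monoˡ-⊑ : ∀ {x y} z → x ⊑ y → x ⊓ z ⊑ y ⊓ z
  ⊓-monoˡ-⊑ {x} {y} z (x⊓y≡x⊓x , _) = x⊓y≡x⇒x⊑y (⊓∈D⊓ x z) (begin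
    x ⊓ z ⊓ (y ⊓ z)  ≡⟨ ⊓-interchange x z y z ⟩
    x ⊓ y ⊓ (z ⊓ z)  ≡⟨ cong (_⊓ (z ⊓ z)) x⊓y≡x⊓x ⟩
    x ⊓ x ⊓ (z ⊓ z)  ≡⟨ ⊓-interchange x x z z ⟩
    x ⊓ z ⊓ (x ⊓ z)  ≡⟨ ⊓∈D⊓ x z ⟩
    x ⊓ z            ∎)

  ⊓-monoʳ-⊑ : ∀ {x y} z → x ⊑ y → z ⊓ x ⊑ z ⊓ y
  ⊓-monoʳ-⊑ {x} {y} z x⊑y = subst₂ _⊑_ (⊓-comm x z) (⊓-comm y z) (⊓-monoˡ-⊑ z x⊑y)

  ⊔-monoˡ-⊑ : ∀ {x y} z → x ⊑ y → x ⊔ z ⊑ y ⊔ z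
  ⊔-monoˡ-⊑ {x} {y} z (_ , x⊔y≡y⊔y) = x⊔y≡y⇒x⊑y (⊔∈D⊔ y z) (begin
    x ⊔ z ⊔ (y ⊔ z)  ≡⟨ ⊔-interchange x z y z ⟩
    x ⊔ y ⊔ (z ⊔ z)  ≡⟨ cong (_⊔ (z ⊔ z)) x⊔y≡y⊔y ⟩
    y ⊔ y ⊔ (z ⊔ z)  ≡⟨ ⊔-interchange y y z z ⟩
    y ⊔ z ⊔ (y ⊔ z)  ≡⟨ ⊔∈D⊔ y z ⟩
    y ⊔ z            ∎)

  ⊔-monoʳ-⊑ : ∀ {x y} z → x ⊑ y → z ⊔ x ⊑ z ⊔ y
  ⊔-monoʳ-⊑ {x} {y} z x⊑y = subst₂ _⊑_ (⊔-comm x z) (⊔-comm y z) (⊔-monoˡ-⊑ z x⊑y)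

  ¬x∨¬y≡¬[x⊓y] : ∀ x y → (¬ x) ∨ (¬ y) ≡ ¬ (x ⊓ y)
  ¬x∨¬y≡¬[x⊓y] x y = begin
    ¬ (¬ ¬ x ⊓ ¬ ¬ y)    ≡⟨ cong ¬_ (cong₂ _⊓_ (¬¬x≡x⊓x x) (¬¬x≡x⊓x y)) ⟩
    ¬ (x ⊓ x ⊓ (y ⊓ y))  ≡⟨ cong ¬_ (⊓-interchange x x y y) ⟩
    ¬ (x ⊓ y ⊓ (x ⊓ y))  ≡⟨ ¬-⊓-idem (x ⊓ y) ⟩
    ¬ (x ⊓ y)            ∎

  ⌟x∧⌟y≡⌟[x⊔y] : ∀ x y → (⌟ x) ∧ (⌟ y) ≡ ⌟ (x ⊔ y)
  ⌟x∧⌟y≡⌟[x⊔y] x y = begin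
    ⌟ (⌟ ⌟ x ⊔ ⌟ ⌟ y)    ≡⟨ cong ⌟_ (cong₂ _⊔_ (⌟⌟x≡x⊔x x) (⌟⌟x≡x⊔x y)) ⟩
    ⌟ (x ⊔ x ⊔ (y ⊔ y))  ≡⟨ cong ⌟_ (⊔-interchange x x y y) ⟩
    ⌟ (x ⊔ y ⊔ (x ⊔ y))  ≡⟨ ⌟-⊔-idem (x ⊔ y) ⟩
    ⌟ (x ⊔ y)            ∎

  ¬-antimono-⊑ : ∀ {x y} → x ⊑ y → ¬ y ⊑ ¬ x
  ¬-antimono-⊑ {x} {y} (x⊓y≡x⊓x , _) = x⊓y≡x⇒x⊑y (¬∈D⊓ y) (begin
    ¬ y ⊓ ¬ x              ≡⟨ cong (¬ y ⊓_) (sym (¬-⊓-idem x)) ⟩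
    ¬ y ⊓ ¬ (x ⊓ x)        ≡⟨ cong (λ t → ¬ y ⊓ ¬ t) (trans (sym x⊓y≡x⊓x) (⊓-comm x y)) ⟩
    ¬ y ⊓ ¬ (y ⊓ x)        ≡⟨ cong (¬ y ⊓_) (sym (¬x∨¬y≡¬[x⊓y] y x)) ⟩
    ¬ y ⊓ ((¬ y) ∨ (¬ x))  ≡⟨ ⊓-absorb-∨ (¬ y) (¬ x) ⟩
    ¬ y ⊓ ¬ y              ≡⟨ ¬∈D⊓ y ⟩
    ¬ y                    ∎)

  ⌟-antimono-⊑ : ∀ {x y} → x ⊑ y → ⌟ y ⊑ ⌟ x
  ⌟-antimono-⊑ {x} {y} (_ , x⊔y≡y⊔y) = x⊔y≡y⇒x⊑y (⌟∈D⊔ x) (begin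
    ⌟ y ⊔ ⌟ x              ≡⟨ ⊔-comm (⌟ y) (⌟ x) ⟩
    ⌟ x ⊔ ⌟ y              ≡⟨ cong (⌟ x ⊔_) (sym (⌟-⊔-idem y)) ⟩
    ⌟ x ⊔ ⌟ (y ⊔ y)        ≡⟨ cong (λ t → ⌟ x ⊔ ⌟ t) (sym x⊔y≡y⊔y) ⟩
    ⌟ x ⊔ ⌟ (x ⊔ y)        ≡⟨ cong (⌟ x ⊔_) (sym (⌟x∧⌟y≡⌟[x⊔y] x y)) ⟩
    ⌟ x ⊔ ((⌟ x) ∧ (⌟ y))  ≡⟨ ⊔-absorb-∧ (⌟ x) (⌟ y) ⟩
    ⌟ x ⊔ ⌟ x              ≡⟨ ⌟∈D⊔ x ⟩
    ⌟ x                    ∎)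

  x⊑x⊓x⊎x⊔x⊑x : ∀ x → x ⊑ x ⊓ x ⊎ x ⊔ x ⊑ x
  x⊑x⊓x⊎x⊔x⊑x x = Sum.map (⊑-reflexive ∘ sym) ⊑-reflexive (pure x)

module FocusedComponent {a p} {X : Set a} (P : Pred X p) where

  focus : ∀ B C {x} → Any P (B ++ x ∷ C) → P x ⊎ Any P (B ++ C)
  focus B C = toSum ∘ Any-resp-↭ (shift _ B C)

  unfocus : ∀ B C {x} → P x ⊎ Any P (B ++ C) → Any P (B ++ x ∷ C)
  unfocus B C = Any-resp-↭ (↭-sym (shift _ B C)) ∘ fromSum

  map-focus : ∀ B C {x y} → (P x → P y) → Any P (B ++ x ∷ C) → Any P (B ++ y ∷ C)
  map-focus B C f = unfocus B C ∘ Sum.map₁ f ∘ focus B C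

  combine : ∀ {q r s} {Q : Set q} {R : Set r} {S : Set s} {Γ Δ} →
    (Q → R → S) → Q ⊎ Any P Γ → R ⊎ Any P Δ → S ⊎ Any P (Γ ++ Δ)
  combine f (inj₁ q) (inj₁ r) = inj₁ (f q r)
  combine f (inj₂ γ) _        = inj₂ (++⁺ˡ γ)
  combine {Γ = Γ} f (inj₁ _) (inj₂ δ) = inj₂ (++⁺ʳ Γ δ)

  open CommutativeMonoidSolver (++-commutativeMonoid {A = X}) using (solve; _⊜_; _⊕_)

  -- A focused component is a solver variable for the list [ x ], as [ x ] ++ C reduces to x ∷ C.
  cut-context↭ : ∀ B C D E x → B ++ D ++ x ∷ C ++ E ↭ x ∷ (B ++ C) ++ (D ++ E)
  cut-context↭ B C D E x =
    solve 5 (λ b c d e y → b ⊕ (d ⊕ (y ⊕ (c ⊕ e))) ⊜ y ⊕ ((b ⊕ c) ⊕ (d ⊕ e)))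
      ↭-refl B C D E [ x ]

  antisym-context↭ : ∀ B C D E F G H K x →
    B ++ D ++ F ++ H ++ x ∷ C ++ E ++ G ++ K ↭
    x ∷ ((B ++ C) ++ (D ++ E)) ++ ((F ++ G) ++ (H ++ K))
  antisym-context↭ B C D E F G H K x =
    solve 9 (λ b c d e f g h k y →
        b ⊕ (d ⊕ (f ⊕ (h ⊕ (y ⊕ (c ⊕ (e ⊕ (g ⊕ k))))))) ⊜
        y ⊕ (((b ⊕ c) ⊕ (d ⊕ e)) ⊕ ((f ⊕ g) ⊕ (h ⊕ k))))
      ↭-refl B C D E F G H K [ x ]

  contract : ∀ B D C → Any P (B ++ D ++ D ++ C) → Any P (B ++ D ++ C)
  contract B D C = [ ++⁺ˡ , ++⁺ʳ B ∘ [ ++⁺ˡ , id ]′ ∘ ++⁻ D ]′ ∘ ++⁻ B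

  exchange : ∀ B D E C → Any P (B ++ D ++ E ++ C) → Any P (B ++ E ++ D ++ C)
  exchange B D E C = Any-resp-↭ (↭.++⁺ˡ B (shifts D E))

module Soundness {c : Level} (Σ : Seq → Set) (A : PDBAO c) (A∈VΣ : InV Σ A) (v : Valuation A) where
  open PDBAO A
  open PDBAOProperties A
  open FocusedComponent (SatSeq A v)

  ⟦_⟧ᵛ : Fm → Carrier
  ⟦ a ⟧ᵛ = ⟦_⟧ A a v

  by-≡ : ∀ {a b} → ⟦ a ⟧ᵛ ≡ ⟦ b ⟧ᵛ → SatH A v [ a ⊢ b ]
  by-≡ = here ∘ ⊑-reflexive

  sound : ∀ {h} → Der Σ h → SatH A v h
  sound (ax-Σ {s} s∈Σ) = here (A∈VΣ s s∈Σ v)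
  sound (ax-id a) = here ⊑-refl
  sound (ax-⊓l a b) = here (x⊓y⊑x ⟦ a ⟧ᵛ ⟦ b ⟧ᵛ)
  sound (ax-⊓r a b) = here (x⊓y⊑y ⟦ a ⟧ᵛ ⟦ b ⟧ᵛ)
  sound (ax-⊔l a b) = here (x⊑x⊔y ⟦ a ⟧ᵛ ⟦ b ⟧ᵛ)
  sound (ax-⊔r a b) = here (y⊑x⊔y ⟦ a ⟧ᵛ ⟦ b ⟧ᵛ)
  sound (ax-⊓dup a b) = by-≡ (sym (⊓∈D⊓ ⟦ a ⟧ᵛ ⟦ b ⟧ᵛ))
  sound (ax-⊔dup a b) = by-≡ (⊔∈D⊔ ⟦ a ⟧ᵛ ⟦ b ⟧ᵛ)
  sound (ax-¬idem a) = by-≡ (¬-⊓-idem ⟦ a ⟧ᵛ)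
  sound (ax-⌟idem a) = by-≡ (sym (⌟-⊔-idem ⟦ a ⟧ᵛ))
  sound (ax-⊓¬ a) = by-≡ (⊓-¬ ⟦ a ⟧ᵛ)
  sound (ax-⊔⌟ a) = by-≡ (sym (⊔-⌟ ⟦ a ⟧ᵛ))
  sound (ax-¬¬₁ a b) = by-≡ (¬¬-⊓ ⟦ a ⟧ᵛ ⟦ b ⟧ᵛ)
  sound (ax-¬¬₂ a b) = by-≡ (sym (¬¬-⊓ ⟦ a ⟧ᵛ ⟦ b ⟧ᵛ))
  sound (ax-⌟⌟₁ a b) = by-≡ (⌟⌟-⊔ ⟦ a ⟧ᵛ ⟦ b ⟧ᵛ)
  sound (ax-⌟⌟₂ a b) = by-≡ (sym (⌟⌟-⊔ ⟦ a ⟧ᵛ ⟦ b ⟧ᵛ))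
  sound (ax-abs⊓ a b) = by-≡ (sym (⊓-absorb ⟦ a ⟧ᵛ ⟦ b ⟧ᵛ))
  sound (ax-abs⊔ a b) = by-≡ (⊔-absorb ⟦ a ⟧ᵛ ⟦ b ⟧ᵛ)
  sound (ax-abs∨ a b) = by-≡ (sym (⊓-absorb-∨ ⟦ a ⟧ᵛ ⟦ b ⟧ᵛ))
  sound (ax-abs∧ a b) = by-≡ (⊔-absorb-∧ ⟦ a ⟧ᵛ ⟦ b ⟧ᵛ)
  sound (ax-dist∨₁ a b c) = by-≡ (⊓-distrib-∨ ⟦ a ⟧ᵛ ⟦ b ⟧ᵛ ⟦ c ⟧ᵛ)
  sound (ax-dist∨₂ a b c) = by-≡ (sym (⊓-distrib-∨ ⟦ a ⟧ᵛ ⟦ b ⟧ᵛ ⟦ c ⟧ᵛ))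
  sound (ax-dist∧₁ a b c) = by-≡ (⊔-distrib-∧ ⟦ a ⟧ᵛ ⟦ b ⟧ᵛ ⟦ c ⟧ᵛ)
  sound (ax-dist∧₂ a b c) = by-≡ (sym (⊔-distrib-∧ ⟦ a ⟧ᵛ ⟦ b ⟧ᵛ ⟦ c ⟧ᵛ))
  sound (ax-⊥ a) = here (⊥⊑x ⟦ a ⟧ᵛ)
  sound (ax-⊤ a) = here (x⊑⊤ ⟦ a ⟧ᵛ)
  sound ax-¬⊤ = by-≡ ¬⊤
  sound ax-⌟⊥ = by-≡ (sym ⌟⊥)
  sound ax-¬⊥₁ = by-≡ ¬⊥
  sound ax-¬⊥₂ = by-≡ (sym ¬⊥)
  sound ax-⌟⊤₁ = by-≡ ⌟⊤
  sound ax-⌟⊤₂ = by-≡ (sym ⌟⊤)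
  sound (ax-mix₁ a) = by-≡ (sym (mixed ⟦ a ⟧ᵛ))
  sound (ax-mix₂ a) = by-≡ (mixed ⟦ a ⟧ᵛ)
  sound (ax-ov₁ p) = by-≡ (Valuation.vo-⊓ v p)
  sound (ax-ov₂ p) = by-≡ (sym (Valuation.vo-⊓ v p))
  sound (ax-pv₁ P) = by-≡ (Valuation.vp-⊔ v P)
  sound (ax-pv₂ P) = by-≡ (sym (Valuation.vp-⊔ v P))
  sound (ax-Sp a) = [ here , there ∘ here ]′ (x⊑x⊓x⊎x⊔x⊑x ⟦ a ⟧ᵛ)
  sound (ax-□⊓₁ a b) = by-≡ (sym (I-⊓ ⟦ a ⟧ᵛ ⟦ b ⟧ᵛ))
  sound (ax-□⊓₂ a b) = by-≡ (I-⊓ ⟦ a ⟧ᵛ ⟦ b ⟧ᵛ)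
  sound (ax-■⊔₁ a b) = by-≡ (sym (C-⊔ ⟦ a ⟧ᵛ ⟦ b ⟧ᵛ))
  sound (ax-■⊔₂ a b) = by-≡ (C-⊔ ⟦ a ⟧ᵛ ⟦ b ⟧ᵛ)
  sound ax-□¬⊥₁ = by-≡ I-¬⊥
  sound ax-□¬⊥₂ = by-≡ (sym I-¬⊥)
  sound ax-■⌟⊤₁ = by-≡ C-⌟⊤
  sound ax-■⌟⊤₂ = by-≡ (sym C-⌟⊤)
  sound (ax-□idem₁ a) = by-≡ (I-idem ⟦ a ⟧ᵛ)
  sound (ax-□idem₂ a) = by-≡ (sym (I-idem ⟦ a ⟧ᵛ))
  sound (ax-■idem₁ a) = by-≡ (C-idem ⟦ a ⟧ᵛ)
  sound (ax-■idem₂ a) = by-≡ (sym (C-idem ⟦ a ⟧ᵛ))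
  sound (r-⊓r B C a b c d) = map-focus B C (⊓-monoˡ-⊑ ⟦ c ⟧ᵛ) (sound d)
  sound (r-⊓l B C a b c d) = map-focus B C (⊓-monoʳ-⊑ ⟦ c ⟧ᵛ) (sound d)
  sound (r-⊔r B C a b c d) = map-focus B C (⊔-monoˡ-⊑ ⟦ c ⟧ᵛ) (sound d)
  sound (r-⊔l B C a b c d) = map-focus B C (⊔-monoʳ-⊑ ⟦ c ⟧ᵛ) (sound d)
  sound (r-¬ B C a b d) = map-focus B C ¬-antimono-⊑ (sound d)
  sound (r-⌟ B C a b d) = map-focus B C ⌟-antimono-⊑ (sound d)
  sound (r-□ B C a b d) = map-focus B C I-mono (sound d)
  sound (r-■ B C a b d) = map-focus B C C-mono (sound d)
  sound (r-cut B C D E a b c d₁ d₂) =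
    Any-resp-↭ (↭-sym (cut-context↭ B C D E (a ⊢ c))) (fromSum
      (combine ⊑-trans (focus B C (sound d₁)) (focus D E (sound d₂))))
  sound (r-antisym B C D E F G H K a b d₁ d₂ d₃ d₄) =
    Any-resp-↭ (↭-sym (antisym-context↭ B C D E F G H K (a ⊢ b))) (fromSum
      (combine (λ (p , q) (r , s) → ⊑-antisym-rule p q r s)
        (combine _,_ (focus B C (sound d₁)) (focus D E (sound d₂)))
        (combine _,_ (focus F G (sound d₃)) (focus H K (sound d₄)))))
  sound (r-EC B D C d) = contract B D C (sound d)
  sound (r-EE B D E C d) = exchange B D E C (sound d)
  sound (r-EW B C d) = ++⁺ˡ (sound d)

theorem46 : ∀ {c : Level} (Σ : Seq → Set) (h : HSeq) → Der Σ h →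
    (A : PDBAO c) → InV Σ A → TrueH A h
theorem46 Σ h d A A∈VΣ v = Soundness.sound Σ A A∈VΣ v d
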